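{- Let $M$ be the MBN built on the two-vertex Boolean network $f_1=\neg x_1\land x_2$, $f_2=x_1\land\neg x_2$ with delay vector $(\alpha,\beta)$. (1) If $\gcd(\alpha+1,\beta+1)=1$, every configuration of $M$ converges to the fixed point $(0,0)$. (2) If $\gcd(\alpha+1,\beta+1)>1$, let $k,\ell$ be the positive integers with $\ell(\alpha+1)=k(\beta+1)=\mathrm{lcm}(\alpha+1,\beta+1)$. Any configuration $(\rho,\gamma)$ for which there exist integers $0\le k_0\le k$, $0\le\ell_0\le\ell$ with $\rho+\ell_0(\alpha+1)=\gamma+k_0(\beta+1)$ converges to the fixed point $(0,0)$; every other configuration evolves towards a limit cycle of length $\mathrm{lcm}(\alpha+1,\beta+1)$.
   Context: The MBN built on a two-vertex Boolean network $(f_1,f_2)$ with delay vector $(\alpha,\beta)$ of positive integers has configurations $(\rho,\gamma)$ with $0\le\rho\le\alpha$, $0\le\gamma\le\beta$, underlying Boolean state $x=([\rho\ge1],[\gamma\ge1])$, and dynamics: the first coordinate becomes $\alpha$ if $f_1(x)=1$, else $\max(\rho-1,0)$; the second becomes $\beta$ if $f_2(x)=1$, else $\max(\gamma-1,0)$. A limit cycle is a periodic orbit of length $\ge2$. -}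

module Defs where

open import Data.Bool using (Bool; true; false; not; _∧_; if_then_else_)
open import Data.Nat using (ℕ; zero; suc; _∸_; _<_; _≤_)
open import Data.Product using (_×_; _,_; ∃)
open import Relation.Binary.PropositionalEquality using (_≡_; _≢_)

BN2 : Set
BN2 = (Bool → Bool → Bool) × (Bool → Bool → Bool)

-- Configurations (ρ , γ); the bounds ρ ≤ α, γ ≤ β are imposed separately.
Config : Set
Config = ℕ × ℕ

pos : ℕ → Bool
pos zero    = false
pos (suc _) = true

mbnStep : BN2 → ℕ → ℕ → Config → Config
mbnStep (f₁ , f₂) α β (ρ , γ) =
  (if f₁ (pos ρ) (pos γ) then α else ρ ∸ 1) ,
  (if f₂ (pos ρ) (pos γ) then β else γ ∸ 1)

netP7 : BN2
netP7 = (λ x₁ x₂ → not x₁ ∧ x₂) , (λ x₁ x₂ → x₁ ∧ not x₂)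

iter : {A : Set} → (A → A) → ℕ → A → A
iter F zero    a = a
iter F (suc n) a = F (iter F n a)

ConvergesTo : {A : Set} → (A → A) → A → A → Set
ConvergesTo F c p = (F p ≡ p) × ∃ λ t → iter F t c ≡ p

HasMinimalPeriod : {A : Set} → (A → A) → A → ℕ → Set
HasMinimalPeriod F c L =
  (0 < L) × (iter F L c ≡ c) × (∀ m → 0 < m → m < L → iter F m c ≢ c)

EvolvesToLimitCycleOfLength : {A : Set} → (A → A) → A → ℕ → Set
EvolvesToLimitCycleOfLength F c L =
  (2 ≤ L) × ∃ λ t → HasMinimalPeriod F (iter F t c) L

{-# OPTIONS --safe #-}
-- Away from the origin the network acts on a configuration (ρ , γ) by two
-- independent cyclic countdowns ρ ↦ ρ - 1 (with 0 ↦ α) and γ ↦ γ - 1 (with 0 ↦ β),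
-- of periods α + 1 and β + 1. The first countdown is at 0 exactly at the times
-- t ≡ ρ (mod α + 1), the second exactly at t ≡ γ (mod β + 1), so the orbit reaches
-- the fixed point (0 , 0) iff these congruences have a common solution. By Bézout
-- they always do when α + 1 and β + 1 are coprime; in general a solution can be
-- reduced modulo the lcm, which yields the bounded (k₀ , ℓ₀). Without a solution
-- the orbit is that of the pair of countdowns, whose minimal period is the lcm.
module Submission where

open import Defs
open import Data.Nat using (ℕ; zero; suc; _+_; _*_; _/_; _%_; _≤_; _<_; s≤s; z≤n; NonZero; >-nonZero)
open import Data.Nat.Properties
open import Data.Nat.DivMod using (m≡m%n+[m/n]*n; [m+kn]%n≡m%n; m%n<n; m<n⇒m%n≡m; m<n*o⇒m/o<n; m≥n⇒m/n>0; %-remove-+ʳ)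
open import Data.Nat.Divisibility using (_∣_; divides; ∣-trans; n∣m*n; ∣⇒≤)
open import Data.Nat.GCD using (gcd; gcd[m,n]∣n; module Bézout)
open import Data.Nat.LCM using (lcm; m∣lcm[m,n]; n∣lcm[m,n]; lcm-least)
open import Data.Nat.Coprimality using (gcd≡1⇒coprime; coprime-Bézout)
open import Data.Nat.Tactic.RingSolver using (solve-∀)
open import Data.Product using (_×_; _,_; ∃; ∃₂; map; proj₁; proj₂)
open import Data.Product.Properties using (≡-dec)
open import Data.Sum using (_⊎_; inj₁; inj₂)
open import Data.Empty using (⊥-elim)
open import Function using (_∘_)
open import Relation.Binary.Definitions using (DecidableEquality)
open import Relation.Binary.PropositionalEquality
open import Relation.Nullary using (¬_; yes; no)

module AgreeingOffFixedPoint {A : Set} (_≟_ : DecidableEquality A) {F G : A → A} {p : A}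
         (Fp≡p : F p ≡ p) (F≗G : ∀ x → x ≢ p → F x ≡ G x) where

  iter-agrees-or-absorbed : ∀ c t → iter F t c ≡ iter G t c ⊎ iter F t c ≡ p
  iter-agrees-or-absorbed c zero = inj₁ refl
  iter-agrees-or-absorbed c (suc t) with iter-agrees-or-absorbed c t
  ... | inj₂ e = inj₂ (trans (cong F e) Fp≡p)
  ... | inj₁ e with iter G t c ≟ p
  ...   | yes z = inj₂ (trans (cong F (trans e z)) Fp≡p)
  ...   | no nz = inj₁ (trans (cong F e) (F≗G _ nz))

  iter-reaches : ∀ c t → iter G t c ≡ p → ConvergesTo F c p
  iter-reaches c t z with iter-agrees-or-absorbed c t
  ... | inj₁ e = Fp≡p , t , trans e z
  ... | inj₂ e = Fp≡p , t , e

  iter-agrees : ∀ c → (∀ t → iter G t c ≢ p) → ∀ t → iter F t c ≡ iter G t c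
  iter-agrees c avoid zero    = refl
  iter-agrees c avoid (suc t) = trans (cong F (iter-agrees c avoid t)) (F≗G _ (avoid t))

countdown : ℕ → ℕ → ℕ
countdown a zero    = a
countdown a (suc x) = x

iter-countdown-≤ : ∀ {a ρ} t → ρ ≤ a → iter (countdown a) t ρ ≤ a
iter-countdown-≤         zero    ρ≤a = ρ≤a
iter-countdown-≤ {a} {ρ} (suc t) ρ≤a = countdown-≤ (iter (countdown a) t ρ) (iter-countdown-≤ t ρ≤a)
  where
  countdown-≤ : ∀ x → x ≤ a → countdown a x ≤ a
  countdown-≤ zero    _   = ≤-refl
  countdown-≤ (suc x) x<a = <⇒≤ x<a

iter-countdown-residue : ∀ a ρ t → ∃ λ q → iter (countdown a) t ρ + t ≡ ρ + q * suc a
iter-countdown-residue a ρ zero    = 0 , refl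
iter-countdown-residue a ρ (suc t) with iter (countdown a) t ρ | iter-countdown-residue a ρ t
... | suc x | q , e = q , trans (+-suc x t) e
... | zero  | q , e = suc q , (begin
  a + suc t               ≡⟨ +-suc a t ⟩
  suc a + t               ≡⟨ cong (suc a +_) e ⟩
  suc a + (ρ + q * suc a) ≡⟨ rearrange (suc a) ρ q ⟩
  ρ + suc q * suc a       ∎)
  where
  open ≡-Reasoning
  rearrange : ∀ A ρ q → A + (ρ + q * A) ≡ ρ + (A + q * A)
  rearrange = solve-∀

residue-unique : ∀ {A x y} u v → x < A → y < A → x + u * A ≡ y + v * A → x ≡ y
residue-unique {A} {x} {y} u v x<A y<A e = begin
  x                 ≡⟨ m<n⇒m%n≡m x<A ⟨
  x % A             ≡⟨ [m+kn]%n≡m%n x u A ⟨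
  (x + u * A) % A   ≡⟨ cong (_% A) e ⟩
  (y + v * A) % A   ≡⟨ [m+kn]%n≡m%n y v A ⟩
  y % A             ≡⟨ m<n⇒m%n≡m y<A ⟩
  y                 ∎
  where
  open ≡-Reasoning
  instance
    A≢0 : NonZero A
    A≢0 = >-nonZero (≤-<-trans z≤n x<A)

iter-countdown≡0⇒ : ∀ a ρ t → iter (countdown a) t ρ ≡ 0 → ∃ λ q → t ≡ ρ + q * suc a
iter-countdown≡0⇒ a ρ t z with iter-countdown-residue a ρ t
... | q , e = q , trans (cong (_+ t) (sym z)) e

≡residue⇒iter-countdown≡0 : ∀ {a ρ t} q → ρ ≤ a → t ≡ ρ + q * suc a → iter (countdown a) t ρ ≡ 0
≡residue⇒iter-countdown≡0 {a} {ρ} {t} q ρ≤a t≡ with iter-countdown-residue a ρ t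
... | q′ , e = residue-unique q q′ (s≤s (iter-countdown-≤ t ρ≤a)) (s≤s z≤n) (+-cancelˡ-≡ ρ _ _ (begin
  ρ + (x + q * suc a) ≡⟨ rearrange ρ x (q * suc a) ⟩
  x + (ρ + q * suc a) ≡⟨ cong (x +_) t≡ ⟨
  x + t               ≡⟨ e ⟩
  ρ + q′ * suc a      ∎))
  where
  open ≡-Reasoning
  x = iter (countdown a) t ρ
  rearrange : ∀ ρ x m → ρ + (x + m) ≡ x + (ρ + m)
  rearrange = solve-∀

iter-countdown≡id⇒∣ : ∀ a ρ t → iter (countdown a) t ρ ≡ ρ → suc a ∣ t
iter-countdown≡id⇒∣ a ρ t fixed with iter-countdown-residue a ρ t
... | q , e = divides q (+-cancelˡ-≡ ρ _ _ (trans (cong (_+ t) (sym fixed)) e))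

∣⇒iter-countdown≡id : ∀ {a ρ t} → ρ ≤ a → suc a ∣ t → iter (countdown a) t ρ ≡ ρ
∣⇒iter-countdown≡id {a} {ρ} {t} ρ≤a (divides q t≡) with iter-countdown-residue a ρ t
... | q′ , e = residue-unique q q′ (s≤s (iter-countdown-≤ t ρ≤a)) (s≤s ρ≤a)
  (trans (cong (iter (countdown a) t ρ +_) (sym t≡)) e)

iter-map : ∀ {A B : Set} (f : A → A) (g : B → B) t x y → iter (map f g) t (x , y) ≡ (iter f t x , iter g t y)
iter-map f g zero    x y = refl
iter-map f g (suc t) x y = cong (map f g) (iter-map f g t x y)

mbnStep-netP7≗countdowns : ∀ α β c → c ≢ (0 , 0) → mbnStep netP7 α β c ≡ map (countdown α) (countdown β) c
mbnStep-netP7≗countdowns α β (zero  , zero)  c≢0 = ⊥-elim (c≢0 refl)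
mbnStep-netP7≗countdowns α β (zero  , suc γ) c≢0 = refl
mbnStep-netP7≗countdowns α β (suc ρ , zero)  c≢0 = refl
mbnStep-netP7≗countdowns α β (suc ρ , suc γ) c≢0 = refl

Bézout⇒common-residue : ∀ {A} β x y → 1 + y * suc β ≡ x * A →
                        ∀ ρ γ → ∃₂ λ j i → ρ + j * A ≡ γ + i * suc β
Bézout⇒common-residue {A} β x y eq ρ γ = d * x , ρ + d * y , (begin
  ρ + d * x * A             ≡⟨ cong (ρ +_) (*-assoc d x A) ⟩
  ρ + d * (x * A)           ≡⟨ cong (λ z → ρ + d * z) eq ⟨
  ρ + d * (1 + y * suc β)   ≡⟨ expand ρ γ β y ⟩
  γ + (ρ + d * y) * suc β   ∎)
  where
  open ≡-Reasoning
  -- rather than γ ∸ ρ, which would need ρ ≤ γ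
  d = γ + ρ * β
  expand : ∀ ρ γ β y → ρ + (γ + ρ * β) * (1 + y * suc β) ≡ γ + (ρ + (γ + ρ * β) * y) * suc β
  expand = solve-∀

coprime⇒common-residue : ∀ α β → gcd (suc α) (suc β) ≡ 1 →
                         ∀ ρ γ → ∃₂ λ j i → ρ + j * suc α ≡ γ + i * suc β
coprime⇒common-residue α β gcd≡1 ρ γ with coprime-Bézout (gcd≡1⇒coprime gcd≡1)
... | Bézout.+- x y eq = Bézout⇒common-residue β x y eq ρ γ
... | Bézout.-+ x y eq with Bézout⇒common-residue α y x eq γ ρ
...   | i , j , e = j , i , sym e

%-multiple-preserves-residue : ∀ {A L ℓ ρ} .{{_ : NonZero A}} .{{_ : NonZero L}} → ℓ * A ≡ L → ρ < A →
                               ∀ j → ∃ λ j′ → j′ < ℓ × (ρ + j * A) % L ≡ ρ + j′ * A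
%-multiple-preserves-residue {A} {L} {ℓ} {ρ} ℓA≡L ρ<A j = r / A , r/A<ℓ , r≡ρ+[r/A]*A
  where
  open ≡-Reasoning
  t = ρ + j * A
  r = t % L
  r%A≡ρ : r % A ≡ ρ
  r%A≡ρ = begin
    r % A                ≡⟨ %-remove-+ʳ r (∣-trans (divides ℓ (sym ℓA≡L)) (n∣m*n (t / L))) ⟨
    (r + t / L * L) % A  ≡⟨ cong (_% A) (m≡m%n+[m/n]*n t L) ⟨
    t % A                ≡⟨ [m+kn]%n≡m%n ρ j A ⟩
    ρ % A                ≡⟨ m<n⇒m%n≡m ρ<A ⟩
    ρ                    ∎
  r≡ρ+[r/A]*A : r ≡ ρ + r / A * A
  r≡ρ+[r/A]*A = trans (m≡m%n+[m/n]*n r A) (cong (_+ r / A * A) r%A≡ρ)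
  r/A<ℓ : r / A < ℓ
  r/A<ℓ = m<n*o⇒m/o<n (subst (r <_) (sym ℓA≡L) (m%n<n t L))

common-residue⇒bounded : ∀ {A B L k ℓ ρ γ} .{{_ : NonZero A}} .{{_ : NonZero B}} .{{_ : NonZero L}} →
                         ℓ * A ≡ L → k * B ≡ L → ρ < A → γ < B →
                         (∃₂ λ j i → ρ + j * A ≡ γ + i * B) →
                         ∃₂ λ k₀ ℓ₀ → k₀ ≤ k × ℓ₀ ≤ ℓ × ρ + ℓ₀ * A ≡ γ + k₀ * B
common-residue⇒bounded {L = L} ℓA≡L kB≡L ρ<A γ<B (j , i , e)
  with %-multiple-preserves-residue ℓA≡L ρ<A j | %-multiple-preserves-residue kB≡L γ<B i
... | j′ , j′<ℓ , ej | i′ , i′<k , ei =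
  i′ , j′ , <⇒≤ i′<k , <⇒≤ j′<ℓ , trans (sym ej) (trans (cong (_% L) e) ei)

-- lcm (suc a) n unfolds to suc a * (n / gcd (suc a) n).
0<lcm : ∀ a b → 0 < lcm (suc a) (suc b)
0<lcm a b = ≤-trans (m≥n⇒m/n>0 {{_}} (∣⇒≤ (gcd[m,n]∣n (suc a) (suc b)))) (m≤m+n _ _)

module _ {α β ρ γ : ℕ} (ρ≤α : ρ ≤ α) (γ≤β : γ ≤ β) where

  private
    F = mbnStep netP7 α β
    D = map (countdown α) (countdown β)

  open AgreeingOffFixedPoint (≡-dec _≟_ _≟_) {F} {D} refl (mbnStep-netP7≗countdowns α β)

  netP7-converges : (∃₂ λ j i → ρ + j * suc α ≡ γ + i * suc β) → ConvergesTo F (ρ , γ) (0 , 0)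
  netP7-converges (j , i , e) =
    iter-reaches (ρ , γ) t (begin
      iter D t (ρ , γ)                                 ≡⟨ iter-map (countdown α) (countdown β) t ρ γ ⟩
      (iter (countdown α) t ρ , iter (countdown β) t γ) ≡⟨ cong₂ _,_ (≡residue⇒iter-countdown≡0 j ρ≤α refl)
                                                                    (≡residue⇒iter-countdown≡0 i γ≤β e) ⟩
      (0 , 0)                                          ∎)
    where
    open ≡-Reasoning
    t = ρ + j * suc α

  netP7-minimal-period : ¬ (∃₂ λ j i → ρ + j * suc α ≡ γ + i * suc β) →
                         HasMinimalPeriod F (ρ , γ) (lcm (suc α) (suc β))
  netP7-minimal-period no-common = 0<lcm α β , L-periodic , not-periodic-below-L
    where
    L = lcm (suc α) (suc β)

    D-avoids-origin : ∀ t → iter D t (ρ , γ) ≢ (0 , 0)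
    D-avoids-origin t D≡0 with iter-countdown≡0⇒ α ρ t (cong proj₁ both≡0) | iter-countdown≡0⇒ β γ t (cong proj₂ both≡0)
      where both≡0 = trans (sym (iter-map (countdown α) (countdown β) t ρ γ)) D≡0
    ... | j , t≡ρ+jA | i , t≡γ+iB = no-common (j , i , trans (sym t≡ρ+jA) t≡γ+iB)

    iter-F≡countdowns : ∀ t → iter F t (ρ , γ) ≡ (iter (countdown α) t ρ , iter (countdown β) t γ)
    iter-F≡countdowns t = trans (iter-agrees (ρ , γ) D-avoids-origin t) (iter-map (countdown α) (countdown β) t ρ γ)

    L-periodic : iter F L (ρ , γ) ≡ (ρ , γ)
    L-periodic = trans (iter-F≡countdowns L) (cong₂ _,_ (∣⇒iter-countdown≡id ρ≤α (m∣lcm[m,n] (suc α) (suc β)))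
                                                        (∣⇒iter-countdown≡id γ≤β (n∣lcm[m,n] (suc α) (suc β))))

    not-periodic-below-L : ∀ m → 0 < m → m < L → iter F m (ρ , γ) ≢ (ρ , γ)
    not-periodic-below-L m 0<m m<L m-periodic = <⇒≱ m<L (∣⇒≤ {{>-nonZero 0<m}} (lcm-least
        (iter-countdown≡id⇒∣ α ρ m (cong proj₁ both-fixed)) (iter-countdown≡id⇒∣ β γ m (cong proj₂ both-fixed))))
      where both-fixed = trans (sym (iter-F≡countdowns m)) m-periodic

proposition7 : (α β : ℕ) → 1 ≤ α → 1 ≤ β →
    (gcd (suc α) (suc β) ≡ 1 →
      ∀ ρ γ → ρ ≤ α → γ ≤ β →
        ConvergesTo (mbnStep netP7 α β) (ρ , γ) (0 , 0))
    ×
    (1 < gcd (suc α) (suc β) →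
      ∀ k ℓ → 1 ≤ k → 1 ≤ ℓ →
        ℓ * suc α ≡ lcm (suc α) (suc β) →
        k * suc β ≡ lcm (suc α) (suc β) →
        ∀ ρ γ → ρ ≤ α → γ ≤ β →
          ((∃₂ λ k₀ ℓ₀ → k₀ ≤ k × ℓ₀ ≤ ℓ × ρ + ℓ₀ * suc α ≡ γ + k₀ * suc β) →
            ConvergesTo (mbnStep netP7 α β) (ρ , γ) (0 , 0))
          ×
          (¬ (∃₂ λ k₀ ℓ₀ → k₀ ≤ k × ℓ₀ ≤ ℓ × ρ + ℓ₀ * suc α ≡ γ + k₀ * suc β) →
            EvolvesToLimitCycleOfLength (mbnStep netP7 α β) (ρ , γ) (lcm (suc α) (suc β))))
proposition7 α β 1≤α _ =
  (λ gcd≡1 ρ γ ρ≤α γ≤β → netP7-converges ρ≤α γ≤β (coprime⇒common-residue α β gcd≡1 ρ γ)) ,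
  λ _ k ℓ _ _ ℓA≡L kB≡L ρ γ ρ≤α γ≤β →
    (λ (k₀ , ℓ₀ , _ , _ , e) → netP7-converges ρ≤α γ≤β (ℓ₀ , k₀ , e)) ,
    λ no-bounded → 2≤lcm , 0 , netP7-minimal-period ρ≤α γ≤β
      (no-bounded ∘ common-residue⇒bounded ℓA≡L kB≡L (s≤s ρ≤α) (s≤s γ≤β))
  where
  instance
    lcm≢0 : NonZero (lcm (suc α) (suc β))
    lcm≢0 = >-nonZero (0<lcm α β)

  2≤lcm : 2 ≤ lcm (suc α) (suc β)
  2≤lcm = ≤-trans (s≤s 1≤α) (∣⇒≤ (m∣lcm[m,n] (suc α) (suc β)))
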